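{- Let $\iota(\omega_f)_p=\left(\begin{smallmatrix}a&b\\c&d\end{smallmatrix}\right)\in M_{ns}$ and let $G=\mathbb{P}^1(\mathbb{F}_p)$ with the group structure described in the context. Then the only element of order $2$ in $G$ is $[-\overline{a}:1]$, and $\iota(-a+\omega_f)_p\in M_{s+}^\times\setminus M_s^\times$. Conversely, if $x_1,x_2\in\mathbb{Z}_p$, not both divisible by $p$, satisfy $\iota(x_1+x_2\omega_f)_p\in M_{s+}$, then $[\overline{x_1}:\overline{x_2}]\in\{[-\overline{a}:1],[1:0]\}$.
   Context: $p$ is an odd prime, $\varepsilon$ a non-square mod $p$, bar denotes reduction mod $p$. Subsets of $M_2(\mathbb{Z}_p)$: $M_{ns}=\{\left(\begin{smallmatrix}a&b\\c&d\end{smallmatrix}\right):a\equiv d,\ b\varepsilon\equiv c\bmod p\}$, $M_s=\{b\equiv c\equiv0\bmod p\}$, $M_{s+}=M_s\cup\{a\equiv d\equiv 0\bmod p\}$; $M_?^\times$ denotes invertible elements. $K$ is an imaginary quadratic field in which $p$ is inert, $f\ge1$ is coprime to $p$, $\mathcal{O}_f=\mathbb{Z}+\omega_f\mathbb{Z}$ is the order of conductor $f$ in $K$, and $X^2-tX+n$ is the characteristic polynomial of $\omega_f$. $B$ is a quaternion algebra over $\mathbb{Q}$ with a fixed identification $B_p=M_2(\mathbb{Q}_p)$, and $\iota:K\to B$ is an embedding with $\iota(\omega_f)_p\in M_{ns}$ (extended $\mathbb{Q}_p$-linearly to $K\otimes\mathbb{Q}_p$). The group $(\mathcal{O}_f\otimes\mathbb{Z}_p)^\times/(\mathcal{O}_{pf}\otimes\mathbb{Z}_p)^\times\simeq(\mathcal{O}_f/p\mathcal{O}_f)^\times/\mathbb{F}_p^\times$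 is identified with $\mathbb{P}^1(\mathbb{F}_p)$ by sending the class of $x_1+x_2\omega_f$ ($x_i\in\mathbb{Z}_p$) to $[\overline{x_1}:\overline{x_2}]$; thus $[1:0]$ is the identity and the multiplication is $[x:1][y:1]=[xy-n:x+y+t]$. -}

module Defs where

open import Data.Nat using (ℕ)
open import Data.Integer using (ℤ; +_; _+_; _-_; _*_; -_)
open import Data.Integer.Divisibility using (_∣_)
open import Data.Product using (_×_; _,_)
open import Data.Sum using (_⊎_)
open import Relation.Nullary using (¬_)

-- Congruence of integers modulo p.  Elements of ℤ_p are represented by
-- integer representatives: every condition in the statement only depends
-- on the reduction modulo p.
_≡_[mod_] : ℤ → ℤ → ℕ → Set
x ≡ y [mod p ] = (+ p) ∣ (x - y)

infix 4 _≡_[mod_]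

NonSquare : ℕ → ℤ → Set
NonSquare p ε = ∀ (x : ℤ) → ¬ (x * x ≡ ε [mod p ])

record Mat : Set where
  constructor mat
  field
    a b c d : ℤ

det : Mat → ℤ
det (mat a b c d) = a * d - b * c

tr : Mat → ℤ
tr (mat a b c d) = a + d

-- x₁ · 1 + x₂ · W  (the image of x₁ + x₂ ω_f when W = ι(ω_f)_p)
lin : ℤ → ℤ → Mat → Mat
lin x₁ x₂ (mat a b c d) = mat (x₁ + x₂ * a) (x₂ * b) (x₂ * c) (x₁ + x₂ * d)

InMns : ℕ → ℤ → Mat → Set
InMns p ε (mat a b c d) = (a ≡ d [mod p ]) × (b * ε ≡ c [mod p ])

InMs : ℕ → Mat → Set
InMs p (mat a b c d) = (b ≡ + 0 [mod p ]) × (c ≡ + 0 [mod p ])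

InMs+ : ℕ → Mat → Set
InMs+ p M@(mat a b c d) = InMs p M ⊎ ((a ≡ + 0 [mod p ]) × (d ≡ + 0 [mod p ]))

Invertible : ℕ → Mat → Set
Invertible p M = ¬ (det M ≡ + 0 [mod p ])

HasCharPoly : ℕ → Mat → ℤ → ℤ → Set
HasCharPoly p W t n = (tr W ≡ t [mod p ]) × (det W ≡ n [mod p ])

-- p is inert in K: the minimal polynomial X² - tX + n of ω_f has no root mod p
Inert : ℕ → ℤ → ℤ → Set
Inert p t n = ∀ (x : ℤ) → ¬ (x * x - t * x + n ≡ + 0 [mod p ])

-- Points of P¹(F_p), given by representatives (x₁, x₂) ∈ ℤ², not both ≡ 0
Pt : Set
Pt = ℤ × ℤ

IsPt : ℕ → Pt → Set
IsPt p (x₁ , x₂) = ¬ ((x₁ ≡ + 0 [mod p ]) × (x₂ ≡ + 0 [mod p ]))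

PEq : ℕ → Pt → Pt → Set
PEq p (x₁ , x₂) (y₁ , y₂) = x₁ * y₂ ≡ x₂ * y₁ [mod p ]

-- group law induced by (O_f/p)^×/F_p^× with ω² = tω - n:
-- (x₁ + x₂ω)(y₁ + y₂ω) = (x₁y₁ - n x₂y₂) + (x₁y₂ + x₂y₁ + t x₂y₂) ω
mulP : ℤ → ℤ → Pt → Pt → Pt
mulP t n (x₁ , x₂) (y₁ , y₂) =
  (x₁ * y₁ - n * (x₂ * y₂) , x₁ * y₂ + x₂ * y₁ + t * (x₂ * y₂))

oneP : Pt
oneP = (+ 1 , + 0)

HasOrder2 : ℕ → ℤ → ℤ → Pt → Set
HasOrder2 p t n g = (¬ PEq p g oneP) × PEq p (mulP t n g g) oneP

{-# OPTIONS --safe #-}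
module Submission where

open import Defs
open import Data.Nat using (ℕ; nonTrivial⇒≢1)
open import Data.Nat.Divisibility using () renaming (_∣_ to _ℕ∣_)
open import Data.Nat.Primality using (Prime; euclidsLemma; prime⇒nonTrivial; irreducible[2])
open import Data.Integer using (ℤ; +_; -_; _-_; _+_; _*_; ∣_∣)
open import Data.Integer.Properties using (abs-*; +-identityʳ; +-inverseʳ)
import Data.Integer.Divisibility.Signed as Signed
open import Data.Integer.Tactic.RingSolver using (solve)
open import Data.List using (_∷_; [])
open import Data.Product using (_×_; _,_; proj₁)
open import Data.Sum using (_⊎_; inj₁; inj₂; map; [_,_]′)
open import Function.Base using (id; _∘_)
open import Function.Bundles using (_⇔_; mk⇔; Equivalence)
open import Level using (0ℓ)
open import Relation.Binary.Bundles using (Setoid)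
open import Relation.Nullary using (¬_; contradiction)
open import Relation.Binary.PropositionalEquality using (_≡_; _≢_; refl; sym; subst)
import Relation.Binary.Reasoning.Setoid as SetoidReasoning

-- Evaluating the characteristic polynomial at a gives a² − t a + n ≡ − b c,
-- so inertness of p makes b c a unit.  Hence ι(−a + ω_f)_p = (0 b ; c d − a)
-- has vanishing diagonal, unit determinant − b c and b ≢ 0.  An element
-- [x₁ : x₂] ≠ [1 : 0] of G has x₂ ≢ 0 and squares to [1 : 0] iff
-- x₂ (2 x₁ + t x₂) ≡ 0; as t ≡ a + d ≡ 2 a and p is odd this means
-- x₁ + a x₂ ≡ 0, i.e. [x₁ : x₂] = [−a : 1].  Finally ι(x₁ + x₂ ω_f)_p ∈ M_s+
-- forces either x₂ b ≡ 0, hence x₂ ≡ 0, or x₁ + a x₂ ≡ 0.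

module Congruence (p : ℕ) where

  infix 4 _≈_

  -- Unlike _≡_[mod_], which unfolds to a statement about ∣ x - y ∣, a record
  -- is injective, so x and y can be inferred from a proof of x ≈ y.
  record _≈_ (x y : ℤ) : Set where
    constructor ≈-intro
    field
      p∣x-y : + p Signed.∣ (x - y)

  open _≈_

  mod⇒≈ : ∀ x y → x ≡ y [mod p ] → x ≈ y
  mod⇒≈ x y x≡y = ≈-intro (Signed.∣ᵤ⇒∣ {+ p} {x - y} x≡y)

  ≈⇒mod : ∀ {x y} → x ≈ y → x ≡ y [mod p ]
  ≈⇒mod {x} {y} x≈y = Signed.∣⇒∣ᵤ {+ p} {x - y} (p∣x-y x≈y)

  ≈-via : ∀ {x y} z → x - y ≡ z → + p Signed.∣ z → x ≈ y
  ≈-via z eq p∣z = ≈-intro (subst (+ p Signed.∣_) (sym eq) p∣z)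

  ≈-refl : ∀ {x} → x ≈ x
  ≈-refl {x} = ≈-via (+ 0) (+-inverseʳ x) (Signed.divides (+ 0) refl)

  ≈-reflexive : ∀ {x y} → x ≡ y → x ≈ y
  ≈-reflexive refl = ≈-refl

  ≈-sym : ∀ {x y} → x ≈ y → y ≈ x
  ≈-sym {x} {y} x≈y = ≈-via (- (x - y)) (solve (x ∷ y ∷ [])) (Signed.∣m⇒∣-m (p∣x-y x≈y))

  ≈-trans : ∀ {x y z} → x ≈ y → y ≈ z → x ≈ z
  ≈-trans {x} {y} {z} x≈y y≈z = ≈-via ((x - y) + (y - z)) (solve (x ∷ y ∷ z ∷ []))
    (Signed.∣m∣n⇒∣m+n (p∣x-y x≈y) (p∣x-y y≈z))

  +-cong : ∀ {x y u v} → x ≈ y → u ≈ v → x + u ≈ y + v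
  +-cong {x} {y} {u} {v} x≈y u≈v = ≈-via ((x - y) + (u - v)) (solve (x ∷ y ∷ u ∷ v ∷ []))
    (Signed.∣m∣n⇒∣m+n (p∣x-y x≈y) (p∣x-y u≈v))

  -‿cong : ∀ {x y} → x ≈ y → - x ≈ - y
  -‿cong {x} {y} x≈y = ≈-via (- (x - y)) (solve (x ∷ y ∷ [])) (Signed.∣m⇒∣-m (p∣x-y x≈y))

  *-cong : ∀ {x y u v} → x ≈ y → u ≈ v → x * u ≈ y * v
  *-cong {x} {y} {u} {v} x≈y u≈v = ≈-via (x * (u - v) + (x - y) * v) (solve (x ∷ y ∷ u ∷ v ∷ []))
    (Signed.∣m∣n⇒∣m+n (Signed.∣n⇒∣m*n x (p∣x-y u≈v)) (Signed.∣m⇒∣m*n v (p∣x-y x≈y)))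

  +-congˡ : ∀ k {u v} → u ≈ v → k + u ≈ k + v
  +-congˡ k = +-cong (≈-refl {k})

  +-congʳ : ∀ k {x y} → x ≈ y → x + k ≈ y + k
  +-congʳ k x≈y = +-cong x≈y (≈-refl {k})

  *-congˡ : ∀ k {u v} → u ≈ v → k * u ≈ k * v
  *-congˡ k = *-cong (≈-refl {k})

  *-congʳ : ∀ k {x y} → x ≈ y → x * k ≈ y * k
  *-congʳ k x≈y = *-cong x≈y (≈-refl {k})

  ≈-setoid : Setoid 0ℓ 0ℓ
  ≈-setoid = record
    { Carrier = ℤ
    ; _≈_ = _≈_
    ; isEquivalence = record { refl = ≈-refl ; sym = ≈-sym ; trans = ≈-trans }
    }

  open SetoidReasoning ≈-setoid public

  ∣⇒≈0 : ∀ {x} → + p Signed.∣ x → x ≈ + 0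
  ∣⇒≈0 {x} = ≈-via x (+-identityʳ x)

  ≈0⇒∣ : ∀ {x} → x ≈ + 0 → + p Signed.∣ x
  ≈0⇒∣ {x} x≈0 = subst (+ p Signed.∣_) (+-identityʳ x) (p∣x-y x≈0)

  *≈0⇒ : Prime p → ∀ {x y} → x * y ≈ + 0 → x ≈ + 0 ⊎ y ≈ + 0
  *≈0⇒ p-prime {x} {y} xy≈0 = map (unsigned⇒≈0 x) (unsigned⇒≈0 y)
    (euclidsLemma ∣ x ∣ ∣ y ∣ p-prime
      (subst (p ℕ∣_) (abs-* x y) (Signed.∣⇒∣ᵤ (≈0⇒∣ xy≈0))))
    where
    unsigned⇒≈0 : ∀ z → p ℕ∣ ∣ z ∣ → z ≈ + 0
    unsigned⇒≈0 z p∣z = ∣⇒≈0 (Signed.∣ᵤ⇒∣ {+ p} {z} p∣z)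

  *≈0-cancelˡ : Prime p → ∀ {x y} → ¬ x ≈ + 0 → x * y ≈ + 0 → y ≈ + 0
  *≈0-cancelˡ p-prime x≉0 xy≈0 = [ (λ x≈0 → contradiction x≈0 x≉0) , id ]′ (*≈0⇒ p-prime xy≈0)

  *≈0-cancelʳ : Prime p → ∀ {x y} → ¬ y ≈ + 0 → x * y ≈ + 0 → x ≈ + 0
  *≈0-cancelʳ p-prime y≉0 xy≈0 = [ id , (λ y≈0 → contradiction y≈0 y≉0) ]′ (*≈0⇒ p-prime xy≈0)

  2≉0 : Prime p → p ≢ 2 → ¬ + 2 ≈ + 0
  2≉0 p-prime p≢2 2≈0 = [ nonTrivial⇒≢1 {{prime⇒nonTrivial p-prime}} , p≢2 ]′
    (irreducible[2] (Signed.∣⇒∣ᵤ (≈0⇒∣ 2≈0)))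

module ProjectiveLine (p : ℕ) where

  open Congruence p
  open Equivalence using (to; from)

  PEq-oneP⇔ : ∀ x₁ x₂ → PEq p (x₁ , x₂) oneP ⇔ x₂ ≈ + 0
  PEq-oneP⇔ x₁ x₂ = mk⇔
    (λ eq → begin
      x₂        ≡⟨ solve (x₂ ∷ []) ⟩
      x₂ * + 1  ≈⟨ mod⇒≈ (x₁ * + 0) (x₂ * + 1) eq ⟨
      x₁ * + 0  ≡⟨ solve (x₁ ∷ []) ⟩
      + 0       ∎)
    (λ x₂≈0 → ≈⇒mod (begin
      x₁ * + 0  ≡⟨ solve (x₁ ∷ []) ⟩
      + 0       ≈⟨ x₂≈0 ⟨
      x₂        ≡⟨ solve (x₂ ∷ []) ⟩
      x₂ * + 1  ∎))

  PEq-[-a:1]⇔ : ∀ x₁ x₂ a → PEq p (x₁ , x₂) (- a , + 1) ⇔ x₁ + x₂ * a ≈ + 0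
  PEq-[-a:1]⇔ x₁ x₂ a = mk⇔
    (λ eq → begin
      x₁ + x₂ * a                ≡⟨ solve (x₁ ∷ x₂ ∷ a ∷ []) ⟩
      x₁ * + 1 - x₂ * (- a)      ≈⟨ +-congʳ (- (x₂ * (- a))) (mod⇒≈ (x₁ * + 1) (x₂ * (- a)) eq) ⟩
      x₂ * (- a) - x₂ * (- a)    ≡⟨ solve (x₂ ∷ a ∷ []) ⟩
      + 0                        ∎)
    (λ e≈0 → ≈⇒mod (begin
      x₁ * + 1                   ≡⟨ solve (x₁ ∷ x₂ ∷ a ∷ []) ⟩
      (x₁ + x₂ * a) - x₂ * a     ≈⟨ +-congʳ (- (x₂ * a)) e≈0 ⟩
      + 0 - x₂ * a               ≡⟨ solve (x₂ ∷ a ∷ []) ⟩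
      x₂ * (- a)                 ∎))

  HasOrder2⇔ : ∀ t n x₁ x₂ →
    HasOrder2 p t n (x₁ , x₂) ⇔ ((¬ x₂ ≈ + 0) × (x₂ * (+ 2 * x₁ + t * x₂) ≈ + 0))
  HasOrder2⇔ t n x₁ x₂ = mk⇔
    (λ (g≢1 , g²≡1) →
      g≢1 ∘ from g≡1⇔ , ≈-trans (≈-reflexive square) (to g²≡1⇔ g²≡1))
    (λ (x₂≉0 , g²≈0) →
      x₂≉0 ∘ to g≡1⇔ , from g²≡1⇔ (≈-trans (≈-reflexive (sym square)) g²≈0))
    where
    g≡1⇔ : PEq p (x₁ , x₂) oneP ⇔ x₂ ≈ + 0
    g≡1⇔ = PEq-oneP⇔ x₁ x₂
    g²≡1⇔ : PEq p (mulP t n (x₁ , x₂) (x₁ , x₂)) oneP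
            ⇔ x₁ * x₂ + x₂ * x₁ + t * (x₂ * x₂) ≈ + 0
    g²≡1⇔ = PEq-oneP⇔ (x₁ * x₁ - n * (x₂ * x₂)) (x₁ * x₂ + x₂ * x₁ + t * (x₂ * x₂))
    square : x₂ * (+ 2 * x₁ + t * x₂) ≡ x₁ * x₂ + x₂ * x₁ + t * (x₂ * x₂)
    square = solve (x₁ ∷ x₂ ∷ t ∷ [])

module CartanEmbedding (p : ℕ) where

  open Congruence p
  open ProjectiveLine p
  open Equivalence using (to; from)

  charPoly-at-a : ∀ a b c d {t n} → a + d ≈ t → a * d - b * c ≈ n →
    a * a - t * a + n ≈ - (b * c)
  charPoly-at-a a b c d {t} {n} tr≈t det≈n = begin
    a * a - t * a + n                        ≈⟨ +-cong (+-congˡ (a * a) (-‿cong (*-congʳ a tr≈t))) det≈n ⟨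
    a * a - (a + d) * a + (a * d - b * c)    ≡⟨ solve (a ∷ b ∷ c ∷ d ∷ []) ⟩
    - (b * c)                                ∎

  inert⇒bc≉0 : ∀ a b c d {t n} → Inert p t n → a + d ≈ t → a * d - b * c ≈ n →
    ¬ b * c ≈ + 0
  inert⇒bc≉0 a b c d {t} {n} inert tr≈t det≈n bc≈0 = inert a (≈⇒mod (begin
    a * a - t * a + n  ≈⟨ charPoly-at-a a b c d tr≈t det≈n ⟩
    - (b * c)          ≈⟨ -‿cong bc≈0 ⟩
    + 0                ∎))

  order2⇔[-a:1] : Prime p → p ≢ 2 → ∀ {a d t n x₁ x₂} → a ≈ d → a + d ≈ t →
    IsPt p (x₁ , x₂) → HasOrder2 p t n (x₁ , x₂) ⇔ PEq p (x₁ , x₂) (- a , + 1)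
  order2⇔[-a:1] p-prime p≢2 {a} {d} {t} {n} {x₁} {x₂} a≈d tr≈t isPt = mk⇔
    (λ order2 → let (x₂≉0 , g²≈0) = to (HasOrder2⇔ t n x₁ x₂) order2 in
      from (PEq-[-a:1]⇔ x₁ x₂ a)
        (*≈0-cancelˡ p-prime x₂≉0 (*≈0-cancelˡ p-prime (2≉0 p-prime p≢2)
          (≈-trans (≈-sym doubled) g²≈0))))
    (λ g≡[-a:1] → let e≈0 = to (PEq-[-a:1]⇔ x₁ x₂ a) g≡[-a:1] in
      from (HasOrder2⇔ t n x₁ x₂)
        ((λ x₂≈0 → isPt (≈⇒mod (x₁≈0 e≈0 x₂≈0) , ≈⇒mod x₂≈0)) , (begin
        x₂ * (+ 2 * x₁ + t * x₂)   ≈⟨ doubled ⟩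
        + 2 * (x₂ * (x₁ + x₂ * a)) ≈⟨ *-congˡ (+ 2) (*-congˡ x₂ e≈0) ⟩
        + 2 * (x₂ * + 0)           ≡⟨ solve (x₂ ∷ []) ⟩
        + 0                        ∎)))
    where
    doubled : x₂ * (+ 2 * x₁ + t * x₂) ≈ + 2 * (x₂ * (x₁ + x₂ * a))
    doubled = begin
      x₂ * (+ 2 * x₁ + t * x₂)        ≈⟨ *-congˡ x₂ (+-congˡ (+ 2 * x₁) (*-congʳ x₂ tr≈t)) ⟨
      x₂ * (+ 2 * x₁ + (a + d) * x₂)  ≈⟨ *-congˡ x₂ (+-congˡ (+ 2 * x₁) (*-congʳ x₂ (+-congˡ a a≈d))) ⟨
      x₂ * (+ 2 * x₁ + (a + a) * x₂)  ≡⟨ solve (a ∷ x₁ ∷ x₂ ∷ []) ⟩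
      + 2 * (x₂ * (x₁ + x₂ * a))      ∎
    x₁≈0 : x₁ + x₂ * a ≈ + 0 → x₂ ≈ + 0 → x₁ ≈ + 0
    x₁≈0 e≈0 x₂≈0 = begin
      x₁                      ≡⟨ solve (x₁ ∷ x₂ ∷ a ∷ []) ⟩
      (x₁ + x₂ * a) - x₂ * a  ≈⟨ +-cong e≈0 (-‿cong (*-congʳ a x₂≈0)) ⟩
      + 0 - + 0 * a           ≡⟨ solve (a ∷ []) ⟩
      + 0                     ∎

  shifted-∈Ms+ : ∀ a b c d → a ≈ d → InMs+ p (lin (- a) (+ 1) (mat a b c d))
  shifted-∈Ms+ a b c d a≈d = inj₂ (≈⇒mod (begin
      - a + + 1 * a  ≡⟨ solve (a ∷ []) ⟩
      + 0            ∎) , ≈⇒mod (begin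
      - a + + 1 * d  ≈⟨ +-congˡ (- a) (*-congˡ (+ 1) a≈d) ⟨
      - a + + 1 * a  ≡⟨ solve (a ∷ []) ⟩
      + 0            ∎))

  shifted-invertible : ∀ a b c d → ¬ b * c ≈ + 0 →
    Invertible p (lin (- a) (+ 1) (mat a b c d))
  shifted-invertible a b c d bc≉0 det≡0 = bc≉0 (begin
    b * c                                                           ≡⟨ solve (a ∷ b ∷ c ∷ d ∷ []) ⟩
    - ((- a + + 1 * a) * (- a + + 1 * d) - (+ 1 * b) * (+ 1 * c))  ≈⟨ -‿cong (mod⇒≈ _ (+ 0) det≡0) ⟩
    + 0                                                             ∎)

  shifted-∉Ms : ∀ a b c d → ¬ b ≈ + 0 → ¬ InMs p (lin (- a) (+ 1) (mat a b c d))
  shifted-∉Ms a b c d b≉0 (b≡0 , _) = b≉0 (begin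
    b      ≡⟨ solve (b ∷ []) ⟩
    + 1 * b ≈⟨ mod⇒≈ _ _ b≡0 ⟩
    + 0    ∎)

  Ms+⇒[-a:1]⊎[1:0] : Prime p → ∀ a b c d x₁ x₂ → ¬ b ≈ + 0 →
    InMs+ p (lin x₁ x₂ (mat a b c d)) → PEq p (x₁ , x₂) (- a , + 1) ⊎ PEq p (x₁ , x₂) oneP
  Ms+⇒[-a:1]⊎[1:0] p-prime a b c d x₁ x₂ b≉0 (inj₁ (x₂b≡0 , _)) =
    inj₂ (from (PEq-oneP⇔ x₁ x₂) (*≈0-cancelʳ p-prime b≉0 (mod⇒≈ (x₂ * b) (+ 0) x₂b≡0)))
  Ms+⇒[-a:1]⊎[1:0] p-prime a b c d x₁ x₂ b≉0 (inj₂ (e≡0 , _)) =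
    inj₁ (from (PEq-[-a:1]⇔ x₁ x₂ a) (mod⇒≈ (x₁ + x₂ * a) (+ 0) e≡0))

lemma3p2 : (p : ℕ) → Prime p → p ≢ 2 →
    (ε : ℤ) → NonSquare p ε →
    (t n : ℤ) → Inert p t n →
    (W : Mat) → InMns p ε W → HasCharPoly p W t n →
    ((g : Pt) → IsPt p g → (HasOrder2 p t n g ⇔ PEq p g (- Mat.a W , + 1)))
    × (InMs+ p (lin (- Mat.a W) (+ 1) W) × Invertible p (lin (- Mat.a W) (+ 1) W)
       × ¬ (InMs p (lin (- Mat.a W) (+ 1) W) × Invertible p (lin (- Mat.a W) (+ 1) W)))
    × ((x₁ x₂ : ℤ) → IsPt p (x₁ , x₂) → InMs+ p (lin x₁ x₂ W) →
       PEq p (x₁ , x₂) (- Mat.a W , + 1) ⊎ PEq p (x₁ , x₂) oneP)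
lemma3p2 p p-prime p≢2 _ _ t n inert (mat a b c d) (a≡d , _) (tr≡t , det≡n) =
    (λ (x₁ , x₂) → order2⇔[-a:1] p-prime p≢2 {n = n} {x₁} {x₂} a≈d tr≈t)
  , ( shifted-∈Ms+ a b c d a≈d
    , shifted-invertible a b c d bc≉0
    , shifted-∉Ms a b c d b≉0 ∘ proj₁)
  , (λ x₁ x₂ _ → Ms+⇒[-a:1]⊎[1:0] p-prime a b c d x₁ x₂ b≉0)
  where
  open Congruence p
  open CartanEmbedding p
  a≈d : a ≈ d
  a≈d = mod⇒≈ a d a≡d
  tr≈t : a + d ≈ t
  tr≈t = mod⇒≈ (a + d) t tr≡t
  bc≉0 : ¬ b * c ≈ + 0
  bc≉0 = inert⇒bc≉0 a b c d inert tr≈t (mod⇒≈ (a * d - b * c) n det≡n)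
  b≉0 : ¬ b ≈ + 0
  b≉0 b≈0 = bc≉0 (≈-trans (*-congʳ c b≈0) (≈-reflexive (solve (c ∷ []))))
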